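{- Let $w\in\mathfrak S_n$ and $R\in\mathrm{SBT}(w)$. Then $$\mathrm{inv}(R)=\ell(\mathrm{perm}(R))-\sum_r\mathrm{coinv}(\mathrm{row}_r(R)),$$ where the sum is over the rows $r$ of $R$ and $\mathrm{coinv}(\mathrm{row}_r(R))$ is the number of pairs of entries $i<j$ in row $r$ with $i$ to the left of $j$.
   Context: $\ell(w)$ is the number of pairs $i<j$ with $w_i>w_j$ (and similarly for any permutation). The Rothe diagram $\mathbb D(w)=\{(i,w_j)\mid i<j,\ w_i>w_j\}$, the cell $(i,w_j)$ lying in row $i$ (rows numbered bottom to top) and column $w_j$; it has $\ell(w)$ cells. A standard balanced tableau of shape $\mathbb D(w)$ is a bijective filling of its cells with $\{1,\ldots,\ell(w)\}$ such that for every cell, the number of cells to its right in the same row with larger entry equals the number of cells above it in the same column with smaller entry; $\mathrm{SBT}(w)$ is the set of these. The inversion number $\mathrm{inv}(R)$ is the number of pairs of entries $i<j$ such that $i$ lies in a strictly higher row than $j$ and in a different column from $j$. The permutation $\mathrm{perm}(R)\in\mathfrak S_{\ell(w)}$ is obtained by rearranging the entries within each row of $R$ into decreasing order from left to right, and then taking the reverse row reading word (each row read right to left, rows taken from bottom to top) as a permutation in one-line notation. -}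

module Defs where

open import Data.Nat using (ℕ; zero; suc; _+_; _<_; _≤_; _<ᵇ_; _≡ᵇ_)
open import Data.Nat.Properties using (≤-decTotalOrder)
open import Data.Bool using (Bool; true; false; _∧_; not; if_then_else_)
open import Data.Fin using (Fin; toℕ)
open import Data.Fin.Permutation using (Permutation′; _⟨$⟩ʳ_)
open import Data.List using (List; []; _∷_; map; length; allFin; reverse; concatMap)
open import Data.Nat.ListAction using (sum)
open import Data.Bool.ListAction using (any)
open import Data.Product using (_×_; _,_; Σ)
open import Relation.Binary.PropositionalEquality using (_≡_)
import Data.List.Sort

bfilter : ∀ {A : Set} → (A → Bool) → List A → List A
bfilter p [] = []
bfilter p (x ∷ xs) = if p x then x ∷ bfilter p xs else bfilter p xs

_<F_ : ∀ {n} → Fin n → Fin n → Bool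
i <F j = toℕ i <ᵇ toℕ j

_=F_ : ∀ {n} → Fin n → Fin n → Bool
i =F j = toℕ i ≡ᵇ toℕ j

countF : ∀ {n} → (Fin n → Bool) → ℕ
countF {n} p = length (bfilter p (allFin n))

sumF : ∀ {n} → (Fin n → ℕ) → ℕ
sumF {n} f = sum (map f (allFin n))

ℓ : ∀ {n} → Permutation′ n → ℕ
ℓ w = sumF (λ i → countF (λ j → (i <F j) ∧ ((w ⟨$⟩ʳ j) <F (w ⟨$⟩ʳ i))))

-- Rothe diagram membership: (i , c) ∈ D(w) iff ∃ j. i < j, w_i > w_j, c = w_j.
-- Rows are indexed by positions i (row 0 is the bottom row, larger index = higher),
-- columns by values c.
isCell : ∀ {n} → Permutation′ n → Fin n → Fin n → Bool
isCell w i c = any (λ j → (i <F j) ∧ ((w ⟨$⟩ʳ j) <F (w ⟨$⟩ʳ i)) ∧ ((w ⟨$⟩ʳ j) =F c)) (allFin _)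

-- A filling: entry R r c in row r, column c (only values on cells matter).
Filling : ℕ → Set
Filling n = Fin n → Fin n → ℕ

IsBijectiveFilling : ∀ {n} → Permutation′ n → Filling n → Set
IsBijectiveFilling {n} w R =
  (∀ r c → isCell w r c ≡ true → 1 ≤ R r c × R r c ≤ ℓ w)
  × (∀ r c r′ c′ → isCell w r c ≡ true → isCell w r′ c′ ≡ true →
       R r c ≡ R r′ c′ → (r ≡ r′ × c ≡ c′))
  × (∀ k → 1 ≤ k → k ≤ ℓ w →
       Σ (Fin n) λ r → Σ (Fin n) λ c → isCell w r c ≡ true × R r c ≡ k)

IsBalanced : ∀ {n} → Permutation′ n → Filling n → Set
IsBalanced w R = ∀ r c → isCell w r c ≡ true →
  countF (λ c′ → isCell w r c′ ∧ (c <F c′) ∧ (R r c <ᵇ R r c′))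
  ≡ countF (λ r′ → isCell w r′ c ∧ (r <F r′) ∧ (R r′ c <ᵇ R r c))

IsSBT : ∀ {n} → Permutation′ n → Filling n → Set
IsSBT w R = IsBijectiveFilling w R × IsBalanced w R

invT : ∀ {n} → Permutation′ n → Filling n → ℕ
invT w R =
  sumF λ r → sumF λ c → if isCell w r c
    then sumF (λ r′ → countF λ c′ → isCell w r′ c′ ∧ (r <F r′) ∧ not (c =F c′)
                                   ∧ (R r′ c′ <ᵇ R r c))
    else 0

rowT : ∀ {n} → Permutation′ n → Filling n → Fin n → List ℕ
rowT {n} w R r = map (R r) (bfilter (isCell w r) (allFin n))

open Data.List.Sort ≤-decTotalOrder using (sort)

decreasing : List ℕ → List ℕ
decreasing xs = reverse (sort xs)

-- reverse row reading word of the row-rearranged tableau: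
-- each row read right to left, rows from bottom (row 0) to top
permT : ∀ {n} → Permutation′ n → Filling n → List ℕ
permT {n} w R = concatMap (λ r → reverse (decreasing (rowT w R r))) (allFin n)

ℓW : List ℕ → ℕ
ℓW [] = 0
ℓW (x ∷ xs) = length (bfilter (λ y → y <ᵇ x) xs) + ℓW xs

coinv : List ℕ → ℕ
coinv [] = 0
coinv (x ∷ xs) = length (bfilter (λ y → x <ᵇ y) xs) + coinv xs

module Submission where

-- Both sides are computed as the same number, the count of pairs of cells
-- ((r , c) , (r′ , c′)) with r′ strictly above r and R r′ c′ < R r c:
--
-- * Reading-word side.  perm R is the concatenation, over the rows from
--   bottom to top, of the increasingly sorted rows.  A sorted block has no
--   inversions, so ℓ(perm R) is the sum over row pairs r < r′ of the number
--   of entries of row r′ smaller than an entry of row r; sorting a row does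
--   not change such counts.
-- * Tableau side.  For a fixed cell, those pairs with c′ ≠ c are counted by
--   inv(R), the ones with c′ = c are the smaller entries above it in its
--   column.  By the balanced condition these are as many as the larger
--   entries to its right in its row, and summing those over a row gives the
--   coinversions of the row.

open import Defs
open import Data.Nat using (ℕ; zero; suc; _+_; _≤_; _<ᵇ_)
open import Data.Nat.Properties using (≤-decTotalOrder; <ᵇ⇒<; ≤⇒≯; +-identityʳ)
open import Data.Nat.ListAction using (sum)
open import Data.Nat.ListAction.Properties using (sum-++; sum-↭)
open import Data.Nat.Tactic.RingSolver using (solve-∀)
open import Data.Bool using (Bool; true; false; T; _∧_; not; if_then_else_)
open import Data.Bool.Properties using (∧-zeroʳ)
open import Data.Unit using (tt)
open import Data.Empty using (⊥-elim)
open import Data.Product using (_,_)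
open import Data.Fin using (Fin; zero; suc)
open import Data.Fin.Permutation using (Permutation′)
open import Data.List using (List; []; _∷_; _++_; map; length; allFin; reverse; concatMap)
open import Data.List.Properties using (map-++; map-∘; map-tabulate; reverse-involutive)
open import Data.List.Relation.Binary.Permutation.Propositional using (_↭_)
open import Data.List.Relation.Binary.Permutation.Propositional.Properties using (map⁺)
open import Data.List.Relation.Unary.All using (All; []; _∷_)
open import Data.List.Relation.Unary.AllPairs using (AllPairs; []; _∷_)
open import Data.List.Relation.Unary.Sorted.TotalOrder.Properties using (Sorted⇒AllPairs)
open import Data.List.Sort ≤-decTotalOrder using (sort; sort-↗; sort-↭)
open import Relation.Binary.Bundles using (DecTotalOrder)
open import Relation.Binary.PropositionalEquality
open ≡-Reasoning

sumL : ∀ {A : Set} → (A → ℕ) → List A → ℕ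
sumL f xs = sum (map f xs)

sumL-cong : ∀ {A : Set} {f g : A → ℕ} (xs : List A) →
  (∀ x → f x ≡ g x) → sumL f xs ≡ sumL g xs
sumL-cong []       f≡g = refl
sumL-cong (x ∷ xs) f≡g = cong₂ _+_ (f≡g x) (sumL-cong xs f≡g)

sumL-zero : ∀ {A : Set} {f : A → ℕ} (xs : List A) → (∀ x → f x ≡ 0) → sumL f xs ≡ 0
sumL-zero xs f≡0 = trans (sumL-cong xs f≡0) (zeros xs)
  where
  zeros : ∀ {A : Set} (xs : List A) → sumL (λ _ → 0) xs ≡ 0
  zeros []       = refl
  zeros (_ ∷ xs) = zeros xs

sumL-+ : ∀ {A : Set} (f g : A → ℕ) (xs : List A) →
  sumL (λ x → f x + g x) xs ≡ sumL f xs + sumL g xs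
sumL-+ f g []       = refl
sumL-+ f g (x ∷ xs) = trans (cong (f x + g x +_) (sumL-+ f g xs)) (interchange (f x) (g x) _ _)
  where
  interchange : ∀ a b c d → (a + b) + (c + d) ≡ (a + c) + (b + d)
  interchange = solve-∀

sumL-swap : ∀ {A B : Set} (f : A → B → ℕ) (xs : List A) (ys : List B) →
  sumL (λ x → sumL (f x) ys) xs ≡ sumL (λ y → sumL (λ x → f x y) xs) ys
sumL-swap f []       ys = sym (sumL-zero ys (λ _ → refl))
sumL-swap f (x ∷ xs) ys = trans (cong (sumL (f x) ys +_) (sumL-swap f xs ys))
  (sym (sumL-+ (f x) (λ y → sumL (λ x → f x y) xs) ys))

sumL-++ : ∀ {A : Set} (f : A → ℕ) (xs ys : List A) →
  sumL f (xs ++ ys) ≡ sumL f xs + sumL f ys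
sumL-++ f xs ys = trans (cong sum (map-++ f xs ys)) (sum-++ (map f xs) (map f ys))

sumL-map : ∀ {A B : Set} (f : B → ℕ) (h : A → B) (xs : List A) →
  sumL f (map h xs) ≡ sumL (λ x → f (h x)) xs
sumL-map f h xs = cong sum (sym (map-∘ xs))

sumL-↭ : ∀ {A : Set} (f : A → ℕ) {xs ys : List A} → xs ↭ ys → sumL f xs ≡ sumL f ys
sumL-↭ f p = sum-↭ (map⁺ f p)

sumL-guard : ∀ {A : Set} (b : Bool) (f : A → ℕ) (xs : List A) →
  (if b then sumL f xs else 0) ≡ sumL (λ x → if b then f x else 0) xs
sumL-guard true  f xs = refl
sumL-guard false f xs = sym (sumL-zero xs (λ _ → refl))

sumL-bfilter : ∀ {A : Set} (f : A → ℕ) (q : A → Bool) (xs : List A) →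
  sumL f (bfilter q xs) ≡ sumL (λ x → if q x then f x else 0) xs
sumL-bfilter f q [] = refl
sumL-bfilter f q (x ∷ xs) with q x
... | true  = cong (f x +_) (sumL-bfilter f q xs)
... | false = sumL-bfilter f q xs

ind : Bool → ℕ
ind b = if b then 1 else 0

count≡sum-ind : ∀ {A : Set} (p : A → Bool) (xs : List A) →
  length (bfilter p xs) ≡ sumL (λ x → ind (p x)) xs
count≡sum-ind p [] = refl
count≡sum-ind p (x ∷ xs) with p x
... | true  = cong suc (count≡sum-ind p xs)
... | false = count≡sum-ind p xs

guard-0 : ∀ b → (if b then 0 else 0) ≡ 0
guard-0 true  = refl
guard-0 false = refl

guard₂-ind : ∀ a b l → (if b then (if a then ind l else 0) else 0) ≡ ind (a ∧ b ∧ l)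
guard₂-ind true  true  l = refl
guard₂-ind false true  l = refl
guard₂-ind a     false l = cong ind (sym (∧-zeroʳ a))

guard-comm : ∀ a b (x : ℕ) →
  (if a then (if b then x else 0) else 0) ≡ (if b then (if a then x else 0) else 0)
guard-comm true  b     x = refl
guard-comm false true  x = refl
guard-comm false false x = refl

sumF-suc : ∀ {n} (f : Fin (suc n) → ℕ) → sumF f ≡ f zero + sumF (λ i → f (suc i))
sumF-suc f = cong (f zero +_) (cong sum
  (trans (map-tabulate suc f) (sym (map-tabulate (λ i → i) (λ i → f (suc i))))))

sumF-delta : ∀ {n} (c : Fin n) (x : Fin n → ℕ) →
  sumF (λ c′ → if c =F c′ then x c′ else 0) ≡ x c
sumF-delta {suc n} zero x = begin
    sumF (λ c′ → if zero =F c′ then x c′ else 0)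
  ≡⟨ sumF-suc (λ c′ → if zero =F c′ then x c′ else 0) ⟩
    x zero + sumF {n} (λ _ → 0)
  ≡⟨ cong (x zero +_) (sumL-zero (allFin n) (λ _ → refl)) ⟩
    x zero + 0
  ≡⟨ +-identityʳ (x zero) ⟩
    x zero
  ∎
sumF-delta {suc n} (suc c) x = trans (sumF-suc (λ c′ → if suc c =F c′ then x c′ else 0))
  (sumF-delta c (λ i → x (suc i)))

pairL : ∀ {A : Set} → (A → A → ℕ) → List A → ℕ
pairL g []       = 0
pairL g (x ∷ xs) = sumL (g x) xs + pairL g xs

pairL-map : ∀ {A B : Set} (g : B → B → ℕ) (h : A → B) (xs : List A) →
  pairL g (map h xs) ≡ pairL (λ a b → g (h a) (h b)) xs
pairL-map g h []       = refl
pairL-map g h (x ∷ xs) = cong₂ _+_ (sumL-map (g (h x)) h xs) (pairL-map g h xs)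

pairL-bfilter : ∀ {A : Set} (g : A → A → ℕ) (q : A → Bool) (xs : List A) →
  pairL g (bfilter q xs) ≡ pairL (λ a b → if q a then (if q b then g a b else 0) else 0) xs
pairL-bfilter g q [] = refl
pairL-bfilter g q (x ∷ xs) with q x
... | true  = cong₂ _+_ (sumL-bfilter (g x) q xs) (pairL-bfilter g q xs)
... | false = trans (pairL-bfilter g q xs) (cong (_+ pairL guarded xs) (sym (sumL-zero xs (λ _ → refl))))
  where
  guarded : _ → _ → ℕ
  guarded a b = if q a then (if q b then g a b else 0) else 0

-- Over allFin n the positions are the elements, so pairs are r < r′ in Fin n.
pairL-allFin : ∀ n (g : Fin n → Fin n → ℕ) →
  pairL g (allFin n) ≡ sumF (λ r → sumF (λ r′ → if r <F r′ then g r r′ else 0))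
pairL-allFin zero    g = refl
pairL-allFin (suc n) g = begin
    pairL g (allFin (suc n))
  ≡⟨ cong (pairL g) allFin-suc ⟩
    sumL (g zero) (map suc (allFin n)) + pairL g (map suc (allFin n))
  ≡⟨ cong₂ _+_ (sumL-map (g zero) suc (allFin n))
               (trans (pairL-map g suc (allFin n)) (pairL-allFin n _)) ⟩
    sumF (λ r′ → g zero (suc r′))
      + sumF (λ r → sumF (λ r′ → if r <F r′ then g (suc r) (suc r′) else 0))
  ≡⟨ sym (cong₂ _+_ (sumF-suc (λ r′ → if zero <F r′ then g zero r′ else 0))
                     (sumL-cong (allFin n) (λ r → sumF-suc (λ r′ → if suc r <F r′ then g (suc r) r′ else 0)))) ⟩
    sumF (λ r′ → if zero <F r′ then g zero r′ else 0)
      + sumF (λ r → sumF (λ r′ → if suc r <F r′ then g (suc r) r′ else 0))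
  ≡⟨ sym (sumF-suc (λ r → sumF (λ r′ → if r <F r′ then g r r′ else 0))) ⟩
    sumF (λ r → sumF (λ r′ → if r <F r′ then g r r′ else 0))
  ∎
  where
  allFin-suc : allFin (suc n) ≡ zero ∷ map suc (allFin n)
  allFin-suc = cong (zero ∷_) (sym (map-tabulate (λ i → i) suc))

-- cross xs ys counts the pairs (x , y) ∈ xs × ys with y < x: the inversions
-- of a word xs ++ ys that straddle the two blocks.
cross : List ℕ → List ℕ → ℕ
cross xs ys = sumL (λ x → sumL (λ y → ind (y <ᵇ x)) ys) xs

ℓW-++ : ∀ xs ys → ℓW (xs ++ ys) ≡ ℓW xs + cross xs ys + ℓW ys
ℓW-++ []       ys = refl
ℓW-++ (x ∷ xs) ys = begin
    length (bfilter (_<ᵇ x) (xs ++ ys)) + ℓW (xs ++ ys)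
  ≡⟨ cong₂ _+_ (trans (count≡sum-ind _ (xs ++ ys)) (sumL-++ _ xs ys)) (ℓW-++ xs ys) ⟩
    (sx + sy) + (ℓW xs + cross xs ys + ℓW ys)
  ≡⟨ regroup sx sy (ℓW xs) (cross xs ys) (ℓW ys) ⟩
    (sx + ℓW xs) + (sy + cross xs ys) + ℓW ys
  ≡⟨ cong (λ z → (z + ℓW xs) + (sy + cross xs ys) + ℓW ys) (sym (count≡sum-ind _ xs)) ⟩
    length (bfilter (_<ᵇ x) xs) + ℓW xs + cross (x ∷ xs) ys + ℓW ys
  ∎
  where
  sx = sumL (λ y → ind (y <ᵇ x)) xs
  sy = sumL (λ y → ind (y <ᵇ x)) ys
  regroup : ∀ a b c d e → (a + b) + (c + d + e) ≡ (a + c) + (b + d) + e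
  regroup = solve-∀

ℓW-increasing : ∀ xs → AllPairs _≤_ xs → ℓW xs ≡ 0
ℓW-increasing []       []         = refl
ℓW-increasing (x ∷ xs) (x≤ ∷ incr) = cong₂ _+_ (noneSmaller xs x≤) (ℓW-increasing xs incr)
  where
  noneSmaller : ∀ ys → All (x ≤_) ys → length (bfilter (_<ᵇ x) ys) ≡ 0
  noneSmaller []       []          = refl
  noneSmaller (y ∷ ys) (x≤y ∷ x≤ys) with y <ᵇ x in y<x
  ... | true  = ⊥-elim (≤⇒≯ x≤y (<ᵇ⇒< y x (subst T (sym y<x) tt)))
  ... | false = noneSmaller ys x≤ys

ℓW-sort : ∀ xs → ℓW (sort xs) ≡ 0
ℓW-sort xs = ℓW-increasing (sort xs)
  (Sorted⇒AllPairs (DecTotalOrder.totalOrder ≤-decTotalOrder) (sort-↗ xs))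

cross-↭ : ∀ {xs xs′ ys ys′} → xs ↭ xs′ → ys ↭ ys′ → cross xs ys ≡ cross xs′ ys′
cross-↭ {xs′ = xs′} p q = trans (sumL-↭ _ p) (sumL-cong xs′ (λ x → sumL-↭ _ q))

cross-concatMap : ∀ {A : Set} (f : A → List ℕ) xs (rs : List A) →
  cross xs (concatMap f rs) ≡ sumL (λ b → cross xs (f b)) rs
cross-concatMap f xs []       = sumL-zero xs (λ _ → refl)
cross-concatMap f xs (r ∷ rs) =
  trans (sumL-cong xs (λ x → sumL-++ _ (f r) (concatMap f rs)))
        (trans (sumL-+ _ _ xs) (cong (cross xs (f r) +_) (cross-concatMap f xs rs)))

ℓW-concatMap : ∀ {A : Set} (f : A → List ℕ) → (∀ r → ℓW (f r) ≡ 0) → (rs : List A) →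
  ℓW (concatMap f rs) ≡ pairL (λ a b → cross (f a) (f b)) rs
ℓW-concatMap f noInv []       = refl
ℓW-concatMap f noInv (r ∷ rs) = begin
    ℓW (f r ++ concatMap f rs)
  ≡⟨ ℓW-++ (f r) (concatMap f rs) ⟩
    ℓW (f r) + cross (f r) (concatMap f rs) + ℓW (concatMap f rs)
  ≡⟨ cong₂ (λ a b → a + cross (f r) (concatMap f rs) + b) (noInv r) (ℓW-concatMap f noInv rs) ⟩
    cross (f r) (concatMap f rs) + pairL (λ a b → cross (f a) (f b)) rs
  ≡⟨ cong (_+ _) (cross-concatMap f (f r) rs) ⟩
    pairL (λ a b → cross (f a) (f b)) (r ∷ rs)
  ∎

cross-filtered : ∀ {A B : Set} (f : A → ℕ) (p : A → Bool) (xs : List A)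
  (g : B → ℕ) (q : B → Bool) (ys : List B) →
  cross (map f (bfilter p xs)) (map g (bfilter q ys))
    ≡ sumL (λ x → if p x then sumL (λ y → if q y then ind (g y <ᵇ f x) else 0) ys else 0) xs
cross-filtered f p xs g q ys =
  trans (sumL-map _ f (bfilter p xs))
  (trans (sumL-bfilter _ p xs)
  (sumL-cong xs (λ x → cong (λ z → if p x then z else 0)
    (trans (sumL-map _ g (bfilter q ys)) (sumL-bfilter _ q ys)))))

coinv-map : ∀ {A : Set} (h : A → ℕ) xs → coinv (map h xs) ≡ pairL (λ a b → ind (h a <ᵇ h b)) xs
coinv-map h []       = refl
coinv-map h (x ∷ xs) =
  cong₂ _+_ (trans (count≡sum-ind _ (map h xs)) (sumL-map _ h xs)) (coinv-map h xs)

module Tableau {n : ℕ} (w : Permutation′ n) (R : Filling n) where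

  cell : Fin n → Fin n → Bool
  cell = isCell w

  smallerAboveIn : Fin n → Fin n → Fin n → ℕ
  smallerAboveIn r c r′ = sumF (λ c′ → ind (cell r′ c′ ∧ (r <F r′) ∧ (R r′ c′ <ᵇ R r c)))

  smallerAbove : Fin n → Fin n → ℕ
  smallerAbove r c = sumF (smallerAboveIn r c)

  -- The common value of both sides: smallerAbove summed over all cells.
  abovePairs : ℕ
  abovePairs = sumF (λ r → sumF (λ c → if cell r c then smallerAbove r c else 0))

  -- The part of smallerAbove outside column c: the contribution of (r , c) to inv(R).
  smallerAboveOtherColumn : Fin n → Fin n → ℕ
  smallerAboveOtherColumn r c =
    sumF (λ r′ → countF (λ c′ → cell r′ c′ ∧ (r <F r′) ∧ not (c =F c′) ∧ (R r′ c′ <ᵇ R r c)))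

  -- The two sides of the balanced condition at (r , c).
  smallerAboveInColumn largerRightInRow : Fin n → Fin n → ℕ
  smallerAboveInColumn r c = countF (λ r′ → cell r′ c ∧ (r <F r′) ∧ (R r′ c <ᵇ R r c))
  largerRightInRow     r c = countF (λ c′ → cell r c′ ∧ (c <F c′) ∧ (R r c <ᵇ R r c′))

  -- Every cell above (r , c) lies in column c or not.
  smallerAbove-split : ∀ r c →
    smallerAboveOtherColumn r c + smallerAboveInColumn r c ≡ smallerAbove r c
  smallerAbove-split r c = begin
      smallerAboveOtherColumn r c + smallerAboveInColumn r c
    ≡⟨ cong₂ _+_ (sumL-cong (allFin n) (λ r′ → count≡sum-ind _ (allFin n)))
                 (trans (count≡sum-ind _ (allFin n))
                        (sumL-cong (allFin n) (λ r′ → sym (sumF-delta c (λ c′ → ind (below r′ c′)))))) ⟩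
      sumF (λ r′ → sumF (λ c′ → ind (otherColumn r′ c′)))
        + sumF (λ r′ → sumF (λ c′ → if c =F c′ then ind (below r′ c′) else 0))
    ≡⟨ sym (sumL-+ _ _ (allFin n)) ⟩
      sumF (λ r′ → sumF (λ c′ → ind (otherColumn r′ c′))
                   + sumF (λ c′ → if c =F c′ then ind (below r′ c′) else 0))
    ≡⟨ sumL-cong (allFin n) (λ r′ → trans (sym (sumL-+ _ _ (allFin n)))
         (sumL-cong (allFin n) (λ c′ → columnCases (cell r′ c′) (r <F r′) (c =F c′) (R r′ c′ <ᵇ R r c)))) ⟩
      smallerAbove r c
    ∎
    where
    below otherColumn : Fin n → Fin n → Bool
    below       r′ c′ = cell r′ c′ ∧ (r <F r′) ∧ (R r′ c′ <ᵇ R r c)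
    otherColumn r′ c′ = cell r′ c′ ∧ (r <F r′) ∧ not (c =F c′) ∧ (R r′ c′ <ᵇ R r c)
    columnCases : ∀ a b e l →
      ind (a ∧ b ∧ not e ∧ l) + (if e then ind (a ∧ b ∧ l) else 0) ≡ ind (a ∧ b ∧ l)
    columnCases true  true  true  l     = refl
    columnCases true  true  false true  = refl
    columnCases true  true  false false = refl
    columnCases true  false e     l     = guard-0 e
    columnCases false b     e     l     = guard-0 e

  coinv-row : ∀ r → coinv (rowT w R r) ≡ sumF (λ c → if cell r c then largerRightInRow r c else 0)
  coinv-row r = begin
      coinv (rowT w R r)
    ≡⟨ coinv-map (R r) (bfilter (cell r) (allFin n)) ⟩
      pairL (λ c c′ → ind (R r c <ᵇ R r c′)) (bfilter (cell r) (allFin n))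
    ≡⟨ trans (pairL-bfilter _ (cell r) (allFin n)) (pairL-allFin n _) ⟩
      sumF (λ c → sumF (λ c′ → if c <F c′ then cellPair c c′ else 0))
    ≡⟨ sumL-cong (allFin n) rightOf ⟩
      sumF (λ c → if cell r c then largerRightInRow r c else 0)
    ∎
    where
    cellPair : Fin n → Fin n → ℕ
    cellPair c c′ = (if cell r c then (if cell r c′ then ind (R r c <ᵇ R r c′) else 0) else 0)

    rightOf : ∀ c → sumF (λ c′ → if c <F c′ then cellPair c c′ else 0)
                    ≡ (if cell r c then largerRightInRow r c else 0)
    rightOf c with cell r c
    ... | true  = sym (trans (count≡sum-ind _ (allFin n))
                             (sumL-cong (allFin n) (λ c′ → sym (guard₂-ind (cell r c′) (c <F c′) _))))
    ... | false = sumL-zero (allFin n) (λ c′ → guard-0 (c <F c′))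

  inv+coinv≡abovePairs : IsBalanced w R →
    invT w R + sumF (λ r → coinv (rowT w R r)) ≡ abovePairs
  inv+coinv≡abovePairs balanced = begin
      invT w R + sumF (λ r → coinv (rowT w R r))
    ≡⟨ cong (invT w R +_) (sumL-cong (allFin n) coinv-row) ⟩
      sumF (λ r → sumF (λ c → if cell r c then smallerAboveOtherColumn r c else 0))
        + sumF (λ r → sumF (λ c → if cell r c then largerRightInRow r c else 0))
    ≡⟨ sym (sumL-+ _ _ (allFin n)) ⟩
      sumF (λ r → sumF (λ c → if cell r c then smallerAboveOtherColumn r c else 0)
                  + sumF (λ c → if cell r c then largerRightInRow r c else 0))
    ≡⟨ sumL-cong (allFin n) (λ r → trans (sym (sumL-+ _ _ (allFin n))) (sumL-cong (allFin n) (atCell r))) ⟩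
      abovePairs
    ∎
    where
    atCell : ∀ r c → (if cell r c then smallerAboveOtherColumn r c else 0)
                     + (if cell r c then largerRightInRow r c else 0)
                   ≡ (if cell r c then smallerAbove r c else 0)
    atCell r c with cell r c in isCell
    ... | true  = trans (cong (smallerAboveOtherColumn r c +_) (balanced r c isCell)) (smallerAbove-split r c)
    ... | false = refl

  block : Fin n → List ℕ
  block r = reverse (decreasing (rowT w R r))

  block≡sort : ∀ r → block r ≡ sort (rowT w R r)
  block≡sort r = reverse-involutive _

  rowCross : Fin n → Fin n → ℕ
  rowCross r r′ =
    sumF (λ c → if cell r c then sumF (λ c′ → if cell r′ c′ then ind (R r′ c′ <ᵇ R r c) else 0) else 0)

  cross-blocks : ∀ r r′ → cross (block r) (block r′) ≡ rowCross r r′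
  cross-blocks r r′ = begin
      cross (block r) (block r′)
    ≡⟨ cong₂ cross (block≡sort r) (block≡sort r′) ⟩
      cross (sort (rowT w R r)) (sort (rowT w R r′))
    ≡⟨ cross-↭ (sort-↭ _) (sort-↭ _) ⟩
      cross (rowT w R r) (rowT w R r′)
    ≡⟨ cross-filtered (R r) (cell r) (allFin n) (R r′) (cell r′) (allFin n) ⟩
      rowCross r r′
    ∎

  guard-into-cells : ∀ r r′ →
    (if r <F r′ then rowCross r r′ else 0) ≡ sumF (λ c → if cell r c then smallerAboveIn r c r′ else 0)
  guard-into-cells r r′ =
    trans (sumL-guard (r <F r′) _ (allFin n))
          (sumL-cong (allFin n) (λ c →
            trans (guard-comm (r <F r′) (cell r c) _)
                  (cong (λ z → if cell r c then z else 0)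
                        (trans (sumL-guard (r <F r′) _ (allFin n))
                               (sumL-cong (allFin n) (λ c′ → guard₂-ind (cell r′ c′) (r <F r′) _))))))

  ℓ-perm≡abovePairs : ℓW (permT w R) ≡ abovePairs
  ℓ-perm≡abovePairs = begin
      ℓW (permT w R)
    ≡⟨ ℓW-concatMap block (λ r → trans (cong ℓW (block≡sort r)) (ℓW-sort _)) (allFin n) ⟩
      pairL (λ r r′ → cross (block r) (block r′)) (allFin n)
    ≡⟨ pairL-allFin n _ ⟩
      sumF (λ r → sumF (λ r′ → if r <F r′ then cross (block r) (block r′) else 0))
    ≡⟨ sumL-cong (allFin n) (λ r → sumL-cong (allFin n) (λ r′ →
         trans (cong (λ z → if r <F r′ then z else 0) (cross-blocks r r′)) (guard-into-cells r r′))) ⟩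
      sumF (λ r → sumF (λ r′ → sumF (λ c → if cell r c then smallerAboveIn r c r′ else 0)))
    ≡⟨ sumL-cong (allFin n) (λ r → trans (sumL-swap _ (allFin n) (allFin n))
         (sumL-cong (allFin n) (λ c → sym (sumL-guard (cell r c) (smallerAboveIn r c) (allFin n))))) ⟩
      abovePairs
    ∎

theorem3p19 : (n : ℕ) (w : Permutation′ n) (R : Filling n) → IsSBT w R →
    invT w R + sumF (λ r → coinv (rowT w R r)) ≡ ℓW (permT w R)
theorem3p19 n w R (_ , balanced) =
  trans (inv+coinv≡abovePairs balanced) (sym ℓ-perm≡abovePairs)
  where open Tableau w R
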